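{- Let $G$ be a finite abelian group and $F$ a face of the group cone $\mathcal C(G)$ with trivial Kunz subgroup and Kunz poset $\preceq$ on $G$. If $a,b,c\in G\setminus\{0\}$ satisfy $a\prec a+b$ and $a+b\prec a+b+c$, then $a\prec a+c$ and $a+c\prec a+b+c$.
   Context: For a finite abelian group $(G,+)$ with $m=|G|$, the group cone $\mathcal C(G)\subset\mathbb R^{m-1}$ (coordinates indexed by the nonzero elements of $G$) is the set of all $x$ with $x_a+x_b\ge x_{a+b}$ for all $a,b\in G\setminus\{0\}$ with $a+b\ne0$. The Kunz subgroup of a face $F$ is $H=\{0\}\cup\{h\ne 0: x_h=0 \text{ for all } x\in F\}$. When $H=\{0\}$, the Kunz poset of $F$ is the partial order $\preceq$ on $G$ (it exists, has minimum $0$, and satisfies $a\preceq b\Rightarrow b-a\preceq b$) such that for all $a,b\in G\setminus\{0\}$ with $a+b\ne0$: $x_a+x_b=x_{a+b}$ for all $x\in F$ iff $a\preceq a+b$. We write $a\prec b$ for $a\preceq b$ and $a\neq b$.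
   Formalization: The group cone $\mathcal C(G)$ and its face F are taken in ℚ^(m−1) instead of $\mathbb R^{m-1}$. -}

module Defs where

open import Level using (Level; _⊔_; suc; 0ℓ)
open import Algebra.Bundles using (AbelianGroup)
open import Data.Nat using (ℕ)
open import Data.Fin using (Fin)
open import Data.Product using (Σ; _×_; ∃)
open import Data.Rational using (ℚ; _≤_; 0ℚ) renaming (_+_ to _+ℚ_)
open import Relation.Nullary using (¬_)
open import Relation.Binary.PropositionalEquality using (_≡_)
open import Relation.Binary.Structures using (IsPartialOrder)
open import Function.Bundles using (_⇔_)

record FiniteAbelianGroup (c ℓ : Level) : Set (suc (c ⊔ ℓ)) where
  field
    abelianGroup : AbelianGroup c ℓ
  open AbelianGroup abelianGroup public hiding (_-_)
  field
    size      : ℕ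
    enum      : Fin size → Carrier
    enum-surj : ∀ g → Σ (Fin size) (λ i → enum i ≈ g)

  infixl 6 _+_ _-_
  _+_ : Carrier → Carrier → Carrier
  _+_ = _∙_
  0# : Carrier
  0# = ε
  _-_ : Carrier → Carrier → Carrier
  a - b = a ∙ (b ⁻¹)

module _ {c ℓ : Level} (G : FiniteAbelianGroup c ℓ) where
  open FiniteAbelianGroup G

  NonZero : Carrier → Set ℓ
  NonZero g = ¬ (g ≈ 0#)

  -- A point of ℚ^(G∖{0}): a coordinate function on G (well defined w.r.t. ≈);
  -- the coordinate at 0 is never used by any definition below.
  IsPoint : (Carrier → ℚ) → Set (c ⊔ ℓ)
  IsPoint x = ∀ {g h} → g ≈ h → x g ≡ x h

  InCone : (Carrier → ℚ) → Set (c ⊔ ℓ)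
  InCone x = IsPoint x × (∀ a b → NonZero a → NonZero b → NonZero (a + b) →
                          x (a + b) ≤ (x a +ℚ x b))

  -- The face of C(G) cut out by making tight the defining inequalities
  -- indexed by the pairs in S (faces of a polyhedral cone are exactly these sets).
  InFace : ∀ {s} → (Carrier → Carrier → Set s) → (Carrier → ℚ) → Set (c ⊔ ℓ ⊔ s)
  InFace S x = InCone x × (∀ a b → NonZero a → NonZero b → NonZero (a + b) →
                           S a b → (x a +ℚ x b) ≡ x (a + b))

  TrivialKunzSubgroup : ∀ {s} → (Carrier → Carrier → Set s) → Set (c ⊔ ℓ ⊔ s)
  TrivialKunzSubgroup S =
    ∀ h → NonZero h → ¬ (∀ (x : Carrier → ℚ) → InFace S x → x h ≡ 0ℚ)

  record IsKunzPoset {s p} (S : Carrier → Carrier → Set s)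
                     (_⪯_ : Carrier → Carrier → Set p) : Set (c ⊔ ℓ ⊔ s ⊔ p) where
    field
      isPartialOrder : IsPartialOrder _≈_ _⪯_
      minimum        : ∀ g → 0# ⪯ g
      diff           : ∀ a b → a ⪯ b → (b - a) ⪯ b
      tight⇔         : ∀ a b → NonZero a → NonZero b → NonZero (a + b) →
                       (∀ (x : Carrier → ℚ) → InFace S x → (x a +ℚ x b) ≡ x (a + b))
                       ⇔ (a ⪯ (a + b))

  Strict : ∀ {p} → (Carrier → Carrier → Set p) → Carrier → Carrier → Set (ℓ ⊔ p)
  Strict _⪯_ a b = (a ⪯ b) × ¬ (a ≈ b)

{-# OPTIONS --safe #-}
-- For every x in the face F the cone inequalities give
--   x(a+b+c) = x(a) + x(b) + x(c) ≥ x(a+c) + x(b) ≥ x(a+c+b) = x(a+b+c),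
-- so x(a) + x(c) = x(a+c) and x(a+c) + x(b) = x(a+c+b) hold on all of F, which
-- by the definition of the Kunz poset means a ⪯ a+c ⪯ a+c+b.  Both steps are
-- strict because b, c ≠ 0, and a+c ≠ 0 since otherwise a+b ⪯ a+b+c = b ⪯ a+b.
module Submission where

open import Defs
open import Level using (Level; _⊔_)
open import Data.Product using (_×_; _,_; proj₁; proj₂)
open import Data.Rational as ℚ using (ℚ)
import Data.Rational.Properties as ℚ
open import Relation.Binary.PropositionalEquality as ≡ using (_≡_)
open import Relation.Binary.Structures using (IsPartialOrder)
open import Function.Bundles using (Equivalence)
open import Algebra.Bundles using (AbelianGroup)
import Algebra.Properties.Group as GroupProperties
import Algebra.Properties.AbelianGroup as AbelianGroupProperties
import Algebra.Properties.CommutativeSemigroup as CommutativeSemigroupProperties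

+-cancelʳ-≤ : ∀ r {p q : ℚ} → p ℚ.+ r ℚ.≤ q ℚ.+ r → p ℚ.≤ q
+-cancelʳ-≤ r {p} {q} p+r≤q+r =
  ≡.subst₂ ℚ._≤_ (//-rightDividesʳ r p) (//-rightDividesʳ r q)
    (ℚ.+-monoˡ-≤ (ℚ.- r) p+r≤q+r)
  where open GroupProperties ℚ.+-0-group using (//-rightDividesʳ)

+-squeeze : ∀ {u y t z : ℚ} → y ℚ.≤ u → z ℚ.≤ y ℚ.+ t → u ℚ.+ t ≡ z →
            u ≡ y × y ℚ.+ t ≡ z
+-squeeze {u} {y} {t} y≤u z≤y+t u+t≡z =
  u≡y , ≡.trans (≡.cong (ℚ._+ t) (≡.sym u≡y)) u+t≡z
  where
  u≡y : u ≡ y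
  u≡y = ℚ.≤-antisym (+-cancelʳ-≤ t (≡.subst (ℚ._≤ y ℚ.+ t) (≡.sym u+t≡z) z≤y+t)) y≤u

module _ {c ℓ : Level} (G : FiniteAbelianGroup c ℓ) where
  open FiniteAbelianGroup G
  open GroupProperties group using (identityˡ-unique; identityʳ-unique)
  open AbelianGroupProperties abelianGroup using (xyx⁻¹≈y)
  open CommutativeSemigroupProperties commutativeSemigroup using (xy∙z≈xz∙y)

  Tight : ∀ {s} → (Carrier → Carrier → Set s) → Carrier → Carrier → Set (c ⊔ ℓ ⊔ s)
  Tight S a b = ∀ x → InFace G S x → x a ℚ.+ x b ≡ x (a + b)

  InCone-exchange : ∀ {x} → InCone G x → ∀ {a b c} →
    NonZero G a → NonZero G b → NonZero G c →
    NonZero G (a + c) → NonZero G (a + c + b) →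
    x a ℚ.+ x b ≡ x (a + b) → x (a + b) ℚ.+ x c ≡ x (a + b + c) →
    x a ℚ.+ x c ≡ x (a + c) × x (a + c) ℚ.+ x b ≡ x (a + c + b)
  InCone-exchange {x} (point , cone) {a} {b} {c} a≠0 b≠0 c≠0 a+c≠0 a+c+b≠0 ab bc =
    +-squeeze (cone a c a≠0 c≠0 a+c≠0) (cone (a + c) b a+c≠0 b≠0 a+c+b≠0) (begin
      x a ℚ.+ x c ℚ.+ x b   ≡⟨ ℚ-xy∙z≈xz∙y (x a) (x c) (x b) ⟩
      x a ℚ.+ x b ℚ.+ x c   ≡⟨ ≡.cong (ℚ._+ x c) ab ⟩
      x (a + b) ℚ.+ x c     ≡⟨ bc ⟩
      x (a + b + c)         ≡⟨ point (xy∙z≈xz∙y a b c) ⟩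
      x (a + c + b)         ∎)
    where
    open ≡.≡-Reasoning
    open CommutativeSemigroupProperties (AbelianGroup.commutativeSemigroup ℚ.+-0-abelianGroup)
      renaming (xy∙z≈xz∙y to ℚ-xy∙z≈xz∙y)

  Tight-exchange : ∀ {s} {S : Carrier → Carrier → Set s} {a b c} →
    NonZero G a → NonZero G b → NonZero G c →
    NonZero G (a + c) → NonZero G (a + c + b) →
    Tight S a b → Tight S (a + b) c → Tight S a c × Tight S (a + c) b
  Tight-exchange {S = S} {a} {b} {c} a≠0 b≠0 c≠0 a+c≠0 a+c+b≠0 ab bc =
    (λ x x∈F → proj₁ (exchange x x∈F)) , (λ x x∈F → proj₂ (exchange x x∈F))
    where
    exchange : ∀ x → InFace G S x →
               x a ℚ.+ x c ≡ x (a + c) × x (a + c) ℚ.+ x b ≡ x (a + c + b)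
    exchange x x∈F =
      InCone-exchange (proj₁ x∈F) a≠0 b≠0 c≠0 a+c≠0 a+c+b≠0 (ab x x∈F) (bc x x∈F)

  module KunzPosetProperties {s p} {S : Carrier → Carrier → Set s}
                             {_⪯_ : Carrier → Carrier → Set p}
                             (K : IsKunzPoset G S _⪯_) where
    open IsKunzPoset K
    open IsPartialOrder isPartialOrder using (antisym; ≲-respˡ-≈; ≲-respʳ-≈)

    ⪯0⇒≈0 : ∀ {g} → g ⪯ 0# → g ≈ 0#
    ⪯0⇒≈0 {g} g⪯0 = antisym g⪯0 (minimum g)

    NonZero-upward : ∀ {a b} → a ⪯ b → NonZero G a → NonZero G b
    NonZero-upward a⪯b a≠0 b≈0 = a≠0 (⪯0⇒≈0 (≲-respʳ-≈ b≈0 a⪯b))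

    summand-⪯ : ∀ {a b} → a ⪯ (a + b) → b ⪯ (a + b)
    summand-⪯ {a} {b} a⪯a+b = ≲-respˡ-≈ (xyx⁻¹≈y a b) (diff a (a + b) a⪯a+b)

    ⪯-+⇒Strict : ∀ {a b} → NonZero G b → a ⪯ (a + b) → Strict G _⪯_ a (a + b)
    ⪯-+⇒Strict {a} {b} b≠0 a⪯a+b =
      a⪯a+b , λ a≈a+b → b≠0 (identityʳ-unique a b (sym a≈a+b))

    NonZero-skip : ∀ {a b c} → NonZero G a →
                   a ⪯ (a + b) → (a + b) ⪯ (a + b + c) → NonZero G (a + c)
    NonZero-skip {a} {b} {c} a≠0 a⪯a+b a+b⪯a+b+c a+c≈0 =
      a≠0 (identityˡ-unique a b (antisym a+b⪯b (summand-⪯ a⪯a+b)))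
      where
      a+b+c≈b : a + b + c ≈ b
      a+b+c≈b = trans (sym (xy∙z≈xz∙y a c b)) (trans (∙-congʳ a+c≈0) (identityˡ b))

      a+b⪯b : (a + b) ⪯ b
      a+b⪯b = ≲-respʳ-≈ a+b+c≈b a+b⪯a+b+c

    Strict-respʳ-≈ : ∀ {a b d} → b ≈ d → Strict G _⪯_ a b → Strict G _⪯_ a d
    Strict-respʳ-≈ b≈d (a⪯b , a≉b) =
      ≲-respʳ-≈ b≈d a⪯b , λ a≈d → a≉b (trans a≈d (sym b≈d))

    ⪯-exchange : ∀ {a b c} → NonZero G a → NonZero G b → NonZero G c →
      a ⪯ (a + b) → (a + b) ⪯ (a + b + c) → a ⪯ (a + c) × (a + c) ⪯ (a + c + b)
    ⪯-exchange {a} {b} {c} a≠0 b≠0 c≠0 a⪯a+b a+b⪯a+b+c =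
      Equivalence.to (tight⇔ a c a≠0 c≠0 a+c≠0) (proj₁ tight-ac,ac+b) ,
      Equivalence.to (tight⇔ (a + c) b a+c≠0 b≠0 a+c+b≠0) (proj₂ tight-ac,ac+b)
      where
      a+b≠0 : NonZero G (a + b)
      a+b≠0 = NonZero-upward a⪯a+b a≠0

      a+b+c≠0 : NonZero G (a + b + c)
      a+b+c≠0 = NonZero-upward a+b⪯a+b+c a+b≠0

      a+c≠0 : NonZero G (a + c)
      a+c≠0 = NonZero-skip a≠0 a⪯a+b a+b⪯a+b+c

      a+c+b≠0 : NonZero G (a + c + b)
      a+c+b≠0 a+c+b≈0 = a+b+c≠0 (trans (sym (xy∙z≈xz∙y a c b)) a+c+b≈0)

      tight-ac,ac+b : Tight S a c × Tight S (a + c) b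
      tight-ac,ac+b = Tight-exchange a≠0 b≠0 c≠0 a+c≠0 a+c+b≠0
        (Equivalence.from (tight⇔ a b a≠0 b≠0 a+b≠0) a⪯a+b)
        (Equivalence.from (tight⇔ (a + b) c a+b≠0 c≠0 a+b+c≠0) a+b⪯a+b+c)

proposition3p11 : ∀ {c ℓ s p : Level} (G : FiniteAbelianGroup c ℓ)
    (S : FiniteAbelianGroup.Carrier G → FiniteAbelianGroup.Carrier G → Set s)
    (_⪯_ : FiniteAbelianGroup.Carrier G → FiniteAbelianGroup.Carrier G → Set p) →
    TrivialKunzSubgroup G S → IsKunzPoset G S _⪯_ →
    ∀ a b c → NonZero G a → NonZero G b → NonZero G c →
    Strict G _⪯_ a (FiniteAbelianGroup._+_ G a b) →
    Strict G _⪯_ (FiniteAbelianGroup._+_ G a b) (FiniteAbelianGroup._+_ G (FiniteAbelianGroup._+_ G a b) c) →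
    Strict G _⪯_ a (FiniteAbelianGroup._+_ G a c)
      × Strict G _⪯_ (FiniteAbelianGroup._+_ G a c) (FiniteAbelianGroup._+_ G (FiniteAbelianGroup._+_ G a b) c)
proposition3p11 G S _⪯_ _ K a b c a≠0 b≠0 c≠0 (a⪯a+b , _) (a+b⪯a+b+c , _) =
  ⪯-+⇒Strict c≠0 (proj₁ a⪯a+c⪯a+c+b) ,
  Strict-respʳ-≈ (xy∙z≈xz∙y a c b) (⪯-+⇒Strict b≠0 (proj₂ a⪯a+c⪯a+c+b))
  where
  open FiniteAbelianGroup G using (_+_; commutativeSemigroup)
  open CommutativeSemigroupProperties commutativeSemigroup using (xy∙z≈xz∙y)
  open KunzPosetProperties G K

  a⪯a+c⪯a+c+b : a ⪯ (a + c) × (a + c) ⪯ (a + c + b)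
  a⪯a+c⪯a+c+b = ⪯-exchange a≠0 b≠0 c≠0 a⪯a+b a+b⪯a+b+c
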